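{- Let $n\ge3$, $1\le k<n$, $i\in\mathbb Z_n$, $S_i\subseteq\mathcal F_i$, and $\tau=\tau_0^{u_0}\tau_1^{u_1}\cdots\tau_{n-1}^{u_{n-1}}\in K$ with $u_m\in\{0,1\}$. If $\tau(S_i)=S_i$ (setwise) and $|S_i|$ is odd, then $\tau$ acts trivially on $\mathcal F_i$; equivalently, $u_i=u_{i+1}=\cdots=u_{i+k-1}=0$ (indices in $\mathbb Z_n$).
   Context: For integers $n\ge 3$ and $1\le k<n$, $\mathrm{PX}(n,k)$ has vertex set $\mathbb Z_n\times\mathbb Z_2^k$, vertices written $(i,x)$ with $x=x_0x_1\cdots x_{k-1}$ (bit indices read in $\mathbb Z_k$); $(i,x)$ and $(j,y)$ are adjacent iff (up to swapping) $j=i+1$ in $\mathbb Z_n$, $x=az_1\cdots z_{k-1}$ and $y=z_1\cdots z_{k-1}b$ for some bits $a,b,z_t$. The fibre $\mathcal F_i$ is $\{(i,x):x\in\mathbb Z_2^k\}$. For $s\in\mathbb Z_n$, the automorphism $\tau_s$ is defined by $\tau_s\cdot(i,x)=(i,x^{s-i})$ if $i\in\{s,s-1,\dots,s-k+1\}$ (in $\mathbb Z_n$) and $\tau_s\cdot(i,x)=(i,x)$ otherwise, where $x^t$ denotes $x$ with bit $x_t$ flipped. The $\tau_s$ are commuting involutions and $K=\langle\tau_0,\dots,\tau_{n-1}\rangle\cong\mathbb Z_2^n$; every element of $K$ is uniquely $\tau_0^{u_0}\cdots\tau_{n-1}^{u_{n-1}}$ with $u_m\in\{0,1\}$. -}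

module Defs where

open import Data.Nat using (ℕ; zero; suc; _+_; _∸_; _<_; _<?_)
open import Data.Nat.DivMod using (_%_; m%n<n)
open import Data.Fin using (Fin; toℕ; fromℕ<)
open import Data.Bool using (Bool; true; false; not; if_then_else_)
open import Data.Vec using (Vec; updateAt)
open import Data.Product using (_×_; _,_)
open import Data.List using (foldr)
open import Data.List using (allFin) public
open import Relation.Nullary using (yes; no)

ofℕ : ∀ {n} → ℕ → Fin (suc n)
ofℕ {n} m = fromℕ< (m%n<n m (suc n))

_⊕_ : ∀ {n} → Fin n → Fin n → Fin n
_⊕_ {suc n} i j = ofℕ (toℕ i + toℕ j)

_⊖_ : ∀ {n} → Fin n → Fin n → Fin n
_⊖_ {suc n} i j = ofℕ (toℕ i + (suc n ∸ toℕ j))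

-- Vertices of PX(n,k): (i , x) with i ∈ ℤ_n and x = x₀ x₁ ⋯ x_{k-1} ∈ ℤ₂^k.
Vertex : ℕ → ℕ → Set
Vertex n k = Fin n × Vec Bool k

flipBit : ∀ {k} → Vec Bool k → Fin k → Vec Bool k
flipBit x t = updateAt x t not

τ : ∀ {n k} → Fin n → Vertex n k → Vertex n k
τ {n} {k} s (i , x) with toℕ (s ⊖ i) <? k
... | yes d<k = (i , flipBit x (fromℕ< d<k))
... | no  _   = (i , x)

τ^ : ∀ {n k} → (Fin n → Bool) → Vertex n k → Vertex n k
τ^ {n} u v = foldr (λ s w → if u s then τ s w else w) v (allFin n)

_⊕ℕ_ : ∀ {n} → Fin n → ℕ → Fin n
_⊕ℕ_ {suc n} i m = ofℕ (toℕ i + m)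

-- Restricted to a fibre 𝓕ᵢ, each τₛ flips at most the bit at position s − i, so
-- τ acts on 𝓕ᵢ as the translation x ↦ x ⊕ m of ℤ₂ᵏ with mₜ = u_{i+t}. A nonzero
-- translation is a fixed-point-free involution, and a finite set preserved by a
-- fixed-point-free involution splits into orbits of size two, so it has even size.
module Submission where

open import Defs
open import Data.Nat using (ℕ; _≤_; _<_)
open import Data.Fin using (Fin; toℕ)
open import Data.Bool using (Bool; false)
open import Data.Vec using (Vec)
open import Data.Product using (_×_; _,_; proj₁; ∃-syntax)
open import Data.List using (List; length)
open import Data.List.Relation.Unary.All using (All)
open import Data.List.Relation.Unary.Unique.Propositional using (Unique)
open import Data.List.Membership.Propositional using (_∈_)
open import Relation.Binary.PropositionalEquality using (_≡_)
open import Data.Nat.Base using (_%_)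

open import Data.Nat using (suc; _+_; _∸_; _<?_; _≟_)
open import Data.Nat.Properties using (0≢1+n; +-comm; +-assoc; m+[n∸m]≡n; <⇒≤; <-trans; n<1+n; m<n⇒m<1+n)
open import Data.Nat.DivMod using (%-distribˡ-+; m%n%n≡m%n; [m+n]%n≡m%n; m<n⇒m%n≡m)
open import Data.Nat.Induction using (<-wellFounded)
open import Induction.WellFounded using (Acc; acc)
open import Data.Fin using (zero; suc; fromℕ<)
open import Data.Fin.Properties using (toℕ-fromℕ<; toℕ<n; all?)
open import Data.Bool using (true; not; _∧_; _xor_; if_then_else_)
open import Data.Bool.Properties
  using (true-xor; xor-comm; xor-assoc; xor-same; xor-identityʳ; ∧-identityʳ; ∧-zeroʳ)
open import Data.Vec using (_∷_; lookup; tabulate)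
open import Data.Vec.Properties using (lookup∘tabulate; tabulate∘lookup; tabulate-cong)
open import Data.Product using (proj₂)
open import Data.Product.Properties using () renaming (≡-dec to ×-≡-dec)
open import Data.List using (_∷_; []; foldr; filter)
open import Data.List.Properties using (filter-all; filter-accept; filter-reject)
import Data.List.Relation.Unary.All as All
open import Data.List.Relation.Unary.AllPairs using (_∷_)
open import Data.List.Relation.Unary.Any using (here; there)
open import Data.List.Relation.Unary.Unique.Propositional.Properties using (allFin⁺; filter⁺)
open import Data.List.Membership.Propositional using (_∉_)
open import Data.List.Membership.Propositional.Properties using (∈-allFin; ∈-filter⁺; ∈-filter⁻)
open import Data.Empty using (⊥-elim)
open import Function using (_∘_)
open import Relation.Nullary using (Dec; yes; no; does; ¬?)
open import Relation.Nullary.Decidable using (dec-true; dec-false)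
open import Relation.Binary.Definitions using (DecidableEquality)
open import Relation.Binary.PropositionalEquality
  using (_≢_; _≗_; refl; sym; trans; cong; cong₂; subst; module ≡-Reasoning)
import Data.Bool.Properties as Bool
import Data.Fin.Properties as Fin
import Data.Vec.Properties as Vec

open ≡-Reasoning

xor-trueʳ : ∀ b → b xor true ≡ not b
xor-trueʳ b = trans (xor-comm b true) (true-xor b)

xor-fixed : ∀ a b → a xor b ≡ a → b ≡ false
xor-fixed false b     eq = eq
xor-fixed true  false eq = refl
xor-fixed true  true  ()

translate : ∀ {k} → (Fin k → Bool) → Vec Bool k → Vec Bool k
translate m x = tabulate (λ d → lookup x d xor m d)

module _ {k : ℕ} where

  translate-cong : ∀ {m m′ : Fin k → Bool} → m ≗ m′ → ∀ x → translate m x ≡ translate m′ x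
  translate-cong m≗m′ x = tabulate-cong (λ d → cong (lookup x d xor_) (m≗m′ d))

  translate-identity : ∀ {m : Fin k → Bool} → (∀ d → m d ≡ false) → ∀ x → translate m x ≡ x
  translate-identity {m} m≡0 x = begin
    tabulate (λ d → lookup x d xor m d)   ≡⟨ tabulate-cong (λ d → cong (lookup x d xor_) (m≡0 d)) ⟩
    tabulate (λ d → lookup x d xor false) ≡⟨ tabulate-cong (xor-identityʳ ∘ lookup x) ⟩
    tabulate (lookup x)                   ≡⟨ tabulate∘lookup x ⟩
    x                                     ∎

  translate-∘ : ∀ (m m′ : Fin k → Bool) x →
                translate m (translate m′ x) ≡ translate (λ d → m′ d xor m d) x
  translate-∘ m m′ x = tabulate-cong λ d → begin
    lookup (translate m′ x) d xor m d ≡⟨ cong (_xor m d) (lookup∘tabulate _ d) ⟩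
    (lookup x d xor m′ d) xor m d     ≡⟨ xor-assoc (lookup x d) (m′ d) (m d) ⟩
    lookup x d xor (m′ d xor m d)     ∎

  translate-involutive : ∀ (m : Fin k → Bool) x → translate m (translate m x) ≡ x
  translate-involutive m x = trans (translate-∘ m m x) (translate-identity (xor-same ∘ m) x)

  translate-fixed : ∀ (m : Fin k → Bool) x → translate m x ≡ x → ∀ d → m d ≡ false
  translate-fixed m x fixed d = xor-fixed (lookup x d) (m d) (begin
    lookup x d xor m d         ≡⟨ lookup∘tabulate _ d ⟨
    lookup (translate m x) d   ≡⟨ cong (λ y → lookup y d) fixed ⟩
    lookup x d                 ∎)

lookup-flipBit : ∀ {k} (x : Vec Bool k) t d →
                 lookup (flipBit x t) d ≡ lookup x d xor does (toℕ t ≟ toℕ d)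
lookup-flipBit (b ∷ x) zero    zero    = sym (xor-trueʳ b)
lookup-flipBit (b ∷ x) zero    (suc d) = sym (xor-identityʳ (lookup x d))
lookup-flipBit (b ∷ x) (suc t) zero    = sym (xor-identityʳ b)
lookup-flipBit (b ∷ x) (suc t) (suc d) = lookup-flipBit x t d

flipBit-translate : ∀ {k} (x : Vec Bool k) t →
                    flipBit x t ≡ translate (λ d → does (toℕ t ≟ toℕ d)) x
flipBit-translate x t =
  trans (sym (tabulate∘lookup (flipBit x t))) (tabulate-cong (lookup-flipBit x t))

xorSum : {A : Set} → (A → Bool) → List A → Bool
xorSum b = foldr (λ a → b a xor_) false

module _ {A : Set} (b : A → Bool) {a : A} (support : ∀ {s} → s ≢ a → b s ≡ false) where

  xorSum-∉ : ∀ {as} → a ∉ as → xorSum b as ≡ false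
  xorSum-∉ {[]}     a∉as = refl
  xorSum-∉ {s ∷ as} a∉as =
    cong₂ _xor_ (support (a∉as ∘ here ∘ sym)) (xorSum-∉ (a∉as ∘ there))

  xorSum-∈ : ∀ {as} → Unique as → a ∈ as → xorSum b as ≡ b a
  xorSum-∈ {a ∷ as} (a∉as ∷ _) (here refl) = begin
    b a xor xorSum b as ≡⟨ cong (b a xor_) (xorSum-∉ (λ a∈as → All.lookup a∉as a∈as refl)) ⟩
    b a xor false       ≡⟨ xor-identityʳ (b a) ⟩
    b a                 ∎
  xorSum-∈ {s ∷ as} (s∉as ∷ uniq) (there a∈as) =
    cong₂ _xor_ (support (All.lookup s∉as a∈as)) (xorSum-∈ uniq a∈as)

module _ {A : Set} (_≟ᴬ_ : DecidableEquality A) (f : A → A) where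

  record FreeInvolutionOn (S : List A) : Set where
    field
      closed       : ∀ {v} → v ∈ S → f v ∈ S
      involutive   : ∀ {v} → v ∈ S → f (f v) ≡ v
      fixpointFree : ∀ {v} → v ∈ S → f v ≢ v

  _≢?_ : (w a : A) → Dec (w ≢ a)
  w ≢? a = ¬? (w ≟ᴬ a)

  remove : A → List A → List A
  remove a = filter (_≢? a)

  length-remove : ∀ {a as} → Unique as → a ∈ as → suc (length (remove a as)) ≡ length as
  length-remove {a} {a ∷ as} (a∉as ∷ _) (here refl) = begin
    suc (length (remove a (a ∷ as))) ≡⟨ cong (suc ∘ length) (filter-reject (_≢? a) (λ a≢a → a≢a refl)) ⟩
    suc (length (remove a as))       ≡⟨ cong (suc ∘ length) (filter-all (_≢? a) (All.map (λ a≢w → a≢w ∘ sym) a∉as)) ⟩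
    suc (length as)                  ∎
  length-remove {a} {s ∷ as} (s∉as ∷ uniq) (there a∈as) = begin
    suc (length (remove a (s ∷ as))) ≡⟨ cong (suc ∘ length) (filter-accept (_≢? a) (All.lookup s∉as a∈as)) ⟩
    suc (suc (length (remove a as))) ≡⟨ cong suc (length-remove uniq a∈as) ⟩
    suc (length as)                  ∎

  free-involution-remove-orbit : ∀ {v as} → Unique (v ∷ as) → FreeInvolutionOn (v ∷ as) →
                                 FreeInvolutionOn (remove (f v) as)
  free-involution-remove-orbit {v} {as} (v∉as ∷ _) inv = record
    { closed       = closed′
    ; involutive   = involutive ∘ inS
    ; fixpointFree = fixpointFree ∘ inS
    }
    where
    open FreeInvolutionOn inv
    inS : ∀ {w} → w ∈ remove (f v) as → w ∈ v ∷ as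
    inS = there ∘ proj₁ ∘ ∈-filter⁻ (_≢? f v)
    closed′ : ∀ {w} → w ∈ remove (f v) as → f w ∈ remove (f v) as
    closed′ {w} w∈ with ∈-filter⁻ (_≢? f v) w∈ | closed (inS w∈)
    ... | _ , w≢fv | here fw≡v = ⊥-elim (w≢fv (trans (sym (involutive (inS w∈))) (cong f fw≡v)))
    ... | w∈as , _ | there fw∈as = ∈-filter⁺ (_≢? f v) fw∈as λ fw≡fv →
      All.lookup v∉as w∈as (begin
        v         ≡⟨ involutive (here refl) ⟨
        f (f v)   ≡⟨ cong f fw≡fv ⟨
        f (f w)   ≡⟨ involutive (inS w∈) ⟩
        w         ∎)

  free-involution-length-even : ∀ {S} → Acc _<_ (length S) → Unique S → FreeInvolutionOn S →
                                length S % 2 ≡ 0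
  free-involution-length-even {[]}     _         _    _   = refl
  free-involution-length-even {v ∷ as} (acc rec) uniq@(_ ∷ uniq-as) inv = begin
    suc (length as) % 2          ≡⟨ cong (λ l → suc l % 2) (length-remove uniq-as fv∈as) ⟨
    length (remove (f v) as) % 2 ≡⟨ free-involution-length-even (rec shorter) (filter⁺ _ uniq-as)
                                      (free-involution-remove-orbit uniq inv) ⟩
    0                            ∎
    where
    open FreeInvolutionOn inv
    fv∈as : f v ∈ as
    fv∈as with closed (here refl)
    ... | here fv≡v = ⊥-elim (fixpointFree (here refl) fv≡v)
    ... | there fv∈as = fv∈as
    shorter : length (remove (f v) as) < suc (length as)
    shorter = subst (λ l → length (remove (f v) as) < suc l) (length-remove uniq-as fv∈as)
                    (m<n⇒m<1+n (n<1+n _))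

module _ {n : ℕ} where
  private
    N = suc n

    toℕ-ofℕ : ∀ m → toℕ (ofℕ {n} m) ≡ m % N
    toℕ-ofℕ m = toℕ-fromℕ< _

    %-absorbˡ : ∀ a b → (a % N + b) % N ≡ (a + b) % N
    %-absorbˡ a b = begin
      (a % N + b) % N              ≡⟨ %-distribˡ-+ (a % N) b N ⟩
      (a % N % N + b % N) % N      ≡⟨ cong (λ z → (z + b % N) % N) (m%n%n≡m%n a N) ⟩
      (a % N + b % N) % N          ≡⟨ %-distribˡ-+ a b N ⟨
      (a + b) % N                  ∎

    +-∸-cancel : ∀ {i} a → i ≤ N → i + a + (N ∸ i) ≡ a + N
    +-∸-cancel {i} a i≤N = begin
      i + a + (N ∸ i)     ≡⟨ cong (_+ (N ∸ i)) (+-comm i a) ⟩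
      a + i + (N ∸ i)     ≡⟨ +-assoc a i (N ∸ i) ⟩
      a + (i + (N ∸ i))   ≡⟨ cong (a +_) (m+[n∸m]≡n i≤N) ⟩
      a + N               ∎

  toℕ-⊕ℕ-⊖ : (i : Fin N) {m : ℕ} → m < N → toℕ ((i ⊕ℕ m) ⊖ i) ≡ m
  toℕ-⊕ℕ-⊖ i {m} m<N = begin
    toℕ (ofℕ {n} (toℕ (i ⊕ℕ m) + (N ∸ toℕ i)))    ≡⟨ toℕ-ofℕ (toℕ (i ⊕ℕ m) + (N ∸ toℕ i)) ⟩
    (toℕ (ofℕ {n} (toℕ i + m)) + (N ∸ toℕ i)) % N ≡⟨ cong (λ z → (z + (N ∸ toℕ i)) % N) (toℕ-ofℕ (toℕ i + m)) ⟩
    ((toℕ i + m) % N + (N ∸ toℕ i)) % N           ≡⟨ %-absorbˡ (toℕ i + m) (N ∸ toℕ i) ⟩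
    (toℕ i + m + (N ∸ toℕ i)) % N                 ≡⟨ cong (_% N) (+-∸-cancel m (<⇒≤ (toℕ<n i))) ⟩
    (m + N) % N                                   ≡⟨ [m+n]%n≡m%n m N ⟩
    m % N                                         ≡⟨ m<n⇒m%n≡m m<N ⟩
    m                                             ∎

  ⊕ℕ-toℕ-⊖ : (i s : Fin N) → i ⊕ℕ toℕ (s ⊖ i) ≡ s
  ⊕ℕ-toℕ-⊖ i s = Fin.toℕ-injective (begin
    toℕ (ofℕ {n} (toℕ i + toℕ (s ⊖ i)))       ≡⟨ toℕ-ofℕ (toℕ i + toℕ (s ⊖ i)) ⟩
    (toℕ i + toℕ (s ⊖ i)) % N                 ≡⟨ cong (λ z → (toℕ i + z) % N) (toℕ-ofℕ (toℕ s + (N ∸ toℕ i))) ⟩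
    (toℕ i + (toℕ s + (N ∸ toℕ i)) % N) % N   ≡⟨ cong (_% N) (+-comm (toℕ i) _) ⟩
    ((toℕ s + (N ∸ toℕ i)) % N + toℕ i) % N   ≡⟨ %-absorbˡ (toℕ s + (N ∸ toℕ i)) (toℕ i) ⟩
    (toℕ s + (N ∸ toℕ i) + toℕ i) % N         ≡⟨ cong (_% N) (+-comm (toℕ s + (N ∸ toℕ i)) (toℕ i)) ⟩
    (toℕ i + (toℕ s + (N ∸ toℕ i))) % N       ≡⟨ cong (_% N) (+-assoc (toℕ i) (toℕ s) _) ⟨
    (toℕ i + toℕ s + (N ∸ toℕ i)) % N         ≡⟨ cong (_% N) (+-∸-cancel (toℕ s) (<⇒≤ (toℕ<n i))) ⟩
    (toℕ s + N) % N                           ≡⟨ [m+n]%n≡m%n (toℕ s) N ⟩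
    toℕ s % N                                 ≡⟨ m<n⇒m%n≡m (toℕ<n s) ⟩
    toℕ s                                     ∎)

flipsAt : ∀ {n k} → Fin n → Fin n → Fin k → Bool
flipsAt s i d = does (toℕ (s ⊖ i) ≟ toℕ d)

τ-on-fibre : ∀ {n k} (s i : Fin n) (x : Vec Bool k) → τ s (i , x) ≡ (i , translate (flipsAt s i) x)
τ-on-fibre {k = k} s i x with toℕ (s ⊖ i) <? k
... | yes p = cong (i ,_) (trans (flipBit-translate x (fromℕ< p))
                                 (translate-cong (λ d → cong (λ j → does (j ≟ toℕ d)) (toℕ-fromℕ< p)) x))
... | no ¬p = cong (i ,_) (sym (translate-identity (λ d → dec-false (toℕ (s ⊖ i) ≟ toℕ d)
                                   (λ eq → ¬p (subst (_< k) (sym eq) (toℕ<n d)))) x))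

module _ {n k : ℕ} (u : Fin n → Bool) (i : Fin n) where

  τ-step-on-fibre : ∀ s (x : Vec Bool k) →
    (if u s then τ s (i , x) else (i , x)) ≡ (i , translate (λ d → u s ∧ flipsAt s i d) x)
  τ-step-on-fibre s x with u s
  ... | true  = τ-on-fibre s i x
  ... | false = cong (i ,_) (sym (translate-identity (λ _ → refl) x))

  foldr-τ-on-fibre : ∀ ss (x : Vec Bool k) →
    foldr (λ s w → if u s then τ s w else w) (i , x) ss
      ≡ (i , translate (λ d → xorSum (λ s → u s ∧ flipsAt s i d) ss) x)
  foldr-τ-on-fibre []       x = cong (i ,_) (sym (translate-identity (λ _ → refl) x))
  foldr-τ-on-fibre (s ∷ ss) x = begin
    step s (foldr step (i , x) ss)            ≡⟨ cong (step s) (foldr-τ-on-fibre ss x) ⟩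
    step s (i , translate sum x)              ≡⟨ τ-step-on-fibre s (translate sum x) ⟩
    (i , translate bit (translate sum x))     ≡⟨ cong (i ,_) (translate-∘ bit sum x) ⟩
    (i , translate (λ d → sum d xor bit d) x) ≡⟨ cong (i ,_) (translate-cong (λ d → xor-comm (sum d) (bit d)) x) ⟩
    (i , translate (λ d → bit d xor sum d) x) ∎
    where
    step : Fin n → Vertex n k → Vertex n k
    step s w = if u s then τ s w else w
    bit sum : Fin k → Bool
    bit d = u s ∧ flipsAt s i d
    sum d = xorSum (λ s → u s ∧ flipsAt s i d) ss

-- Exactly one τₛ, namely s = i + d, touches bit d of the fibre, because k < n.
τ^-on-fibre : ∀ {n k} (u : Fin (suc n) → Bool) (i : Fin (suc n)) → k < suc n →
              ∀ x → τ^ u (i , x) ≡ (i , translate (λ d → u (i ⊕ℕ toℕ d)) x)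
τ^-on-fibre {n} {k} u i k<N x = begin
  τ^ u (i , x)                                                 ≡⟨ foldr-τ-on-fibre u i (allFin _) x ⟩
  (i , translate (λ d → xorSum (contribution d) (allFin _)) x) ≡⟨ cong (i ,_) (translate-cong total x) ⟩
  (i , translate (λ d → u (i ⊕ℕ toℕ d)) x)                     ∎
  where
  contribution : Fin k → Fin (suc n) → Bool
  contribution d s = u s ∧ flipsAt s i d
  only-at : ∀ d {s} → s ≢ i ⊕ℕ toℕ d → contribution d s ≡ false
  only-at d {s} s≢ = trans (cong (u s ∧_) (dec-false (toℕ (s ⊖ i) ≟ toℕ d) (s≢ ∘ s≡i⊕d))) (∧-zeroʳ (u s))
    where
    s≡i⊕d : toℕ (s ⊖ i) ≡ toℕ d → s ≡ i ⊕ℕ toℕ d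
    s≡i⊕d eq = trans (sym (⊕ℕ-toℕ-⊖ i s)) (cong (i ⊕ℕ_) eq)
  total : ∀ d → xorSum (contribution d) (allFin _) ≡ u (i ⊕ℕ toℕ d)
  total d = begin
    xorSum (contribution d) (allFin _) ≡⟨ xorSum-∈ (contribution d) (only-at d) (allFin⁺ _) (∈-allFin _) ⟩
    u s ∧ flipsAt s i d                ≡⟨ cong (u s ∧_) (dec-true (toℕ (s ⊖ i) ≟ toℕ d) s⊖i≡d) ⟩
    u s ∧ true                         ≡⟨ ∧-identityʳ (u s) ⟩
    u s                                ∎
    where
    s = i ⊕ℕ toℕ d
    s⊖i≡d : toℕ (s ⊖ i) ≡ toℕ d
    s⊖i≡d = toℕ-⊕ℕ-⊖ i (<-trans (toℕ<n d) k<N)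

odd-invariant⇒translation-trivial :
  ∀ {n k} (i : Fin n) (g : Vertex n k → Vertex n k) (m : Fin k → Bool) →
  (∀ x → g (i , x) ≡ (i , translate m x)) →
  (S : List (Vertex n k)) → Unique S → All (λ v → proj₁ v ≡ i) S → (∀ v → v ∈ S → g v ∈ S) →
  length S % 2 ≡ 1 → ∀ d → m d ≡ false
odd-invariant⇒translation-trivial i g m g-on-fibre S uniq inFibre closed odd
  with all? (λ d → m d Bool.≟ false)
... | yes m≡0 = m≡0
... | no  m≢0 = ⊥-elim (0≢1+n (trans (sym even) odd))
  where
  involutive : ∀ {v} → v ∈ S → g (g v) ≡ v
  involutive {_ , x} v∈S with All.lookup inFibre v∈S
  ... | refl = begin
    g (g (i , x))                     ≡⟨ cong g (g-on-fibre x) ⟩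
    g (i , translate m x)             ≡⟨ g-on-fibre (translate m x) ⟩
    (i , translate m (translate m x)) ≡⟨ cong (i ,_) (translate-involutive m x) ⟩
    (i , x)                           ∎
  fixpointFree : ∀ {v} → v ∈ S → g v ≢ v
  fixpointFree {_ , x} v∈S gv≡v with All.lookup inFibre v∈S
  ... | refl = m≢0 (translate-fixed m x (cong proj₂ (trans (sym (g-on-fibre x)) gv≡v)))
  even : length S % 2 ≡ 0
  even = free-involution-length-even (×-≡-dec Fin._≟_ (Vec.≡-dec Bool._≟_)) g (<-wellFounded _) uniq
           record { closed = closed _ ; involutive = involutive ; fixpointFree = fixpointFree }

lemma4p1 : (n k : ℕ) → 3 ≤ n → 1 ≤ k → k < n → (i : Fin n)
    → (S : List (Vertex n k)) → Unique S → All (λ v → proj₁ v ≡ i) S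
    → (u : Fin n → Bool)
    → (∀ v → v ∈ S → τ^ u v ∈ S)
    → (∀ w → w ∈ S → ∃[ v ] (v ∈ S × τ^ u v ≡ w))
    → length S % 2 ≡ 1
    → (∀ (x : Vec Bool k) → τ^ u (i , x) ≡ (i , x))
      × (∀ (t : Fin k) → u (i ⊕ℕ toℕ t) ≡ false)
lemma4p1 (suc n) k _ _ k<n i S uniq inFibre u closed _ odd = fixes , vanishes
  where
  vanishes : ∀ t → u (i ⊕ℕ toℕ t) ≡ false
  vanishes = odd-invariant⇒translation-trivial i (τ^ u) _ (τ^-on-fibre u i k<n) S uniq inFibre closed odd
  fixes : ∀ x → τ^ u (i , x) ≡ (i , x)
  fixes x = trans (τ^-on-fibre u i k<n x) (cong (i ,_) (translate-identity vanishes x))
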